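{- For every $n\ge 1$, the number of integer sequences $e=(e_1,\dots,e_n)$ with $0\le e_i<i$ for all $i\in[n]$ such that there are no indices $i<j<k$ with $e_j\ne e_k$ and $e_i=e_k$ equals the Bell number $B_n$ (the number of set partitions of $[n]$). -}

module Defs where

open import Data.Nat using (ℕ; zero; suc; _+_; _*_; _≤_)
open import Data.Fin using (Fin; toℕ; _<_)
open import Data.Vec using (Vec; lookup)
open import Data.List using (map; upTo)
open import Data.Nat.ListAction using (sum)
open import Relation.Binary.PropositionalEquality using (_≡_; _≢_)

S : ℕ → ℕ → ℕ
S zero    zero    = 1
S zero    (suc k) = 0
S (suc n) zero    = 0
S (suc n) (suc k) = suc k * S n (suc k) + S n k

Bell : ℕ → ℕ
Bell n = sum (map (S n) (upTo (suc n)))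

-- Inversion sequences e = (e_1,…,e_n) with 0 ≤ e_i < i, stored as a
-- vector indexed by Fin n (position i : Fin n stands for index toℕ i + 1,
-- so the bound 0 ≤ e_i < i reads  lookup e i ≤ toℕ i).
-- Both conditions are irrelevant fields so that equality of elements is
-- equality of the underlying vectors (counting the sequences themselves).
record AvoidingInvSeq (n : ℕ) : Set where
  constructor mk
  field
    seq     : Vec ℕ n
    .bound  : ∀ (i : Fin n) → lookup seq i ≤ toℕ i
    .avoids : ∀ (i j k : Fin n) → i < j → j < k →
              lookup seq j ≢ lookup seq k → lookup seq i ≢ lookup seq k

-- Call a value fresh for a sequence ys of length n if it is at most n and does not occur in ys.
-- A sequence avoids 011 iff each entry after the first either repeats its predecessor or is a
-- value not used before.  So an avoiding sequence of length n + 1 is an avoiding sequence ys of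
-- length n followed by either last ys or one of its fresh values.  Repeating the last entry
-- raises the number of fresh values by one (the value n + 1 becomes available); using a fresh
-- value leaves it unchanged (one value is used up, n + 1 becomes available).  Hence the number
-- a(n, k) of avoiding sequences of length n with k fresh values satisfies the recurrence
-- a(n + 1, k + 1) = a(n, k) + (k + 1) a(n, k + 1) of S, and a(1, k) = S(1, k); summing over k
-- gives the Bell number.
module Submission where

open import Defs
open import Data.Nat using (ℕ; _≥_)
open import Data.Fin using (Fin)
open import Function.Bundles using (_↔_)

open import Data.Bool using (Bool; true; false; T; not; _∧_; if_then_else_)
open import Data.Bool.Properties using (T-irrelevant; T?; T-≡; ∧-zeroʳ)
open import Data.Empty using (⊥-elim)
open import Data.Fin as Fin using (zero; suc; toℕ; fromℕ; inject₁)
import Data.Fin.Properties as Fin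
open import Data.Fin.Properties using (toℕ-fromℕ; toℕ-inject₁; ≤fromℕ; inject₁ℕ<)
open import Data.Fin.Relation.Unary.Top using (view; ‵fromℕ; ‵inject₁)
open import Data.List using (applyUpTo)
open import Data.List.Properties using (map-applyUpTo)
open import Data.Nat
  using (zero; suc; _+_; _*_; _<_; _≤_; z≤n; s≤s; s≤s⁻¹; _≟_; _≤?_; _<?_)
open import Data.Nat.ListAction using (sum)
open import Data.Nat.Properties
open import Data.Product using (Σ; Σ-syntax; _×_; _,_; proj₁; proj₂)
import Data.Product.Function.Dependent.Propositional as Σ
open import Data.Product.Function.NonDependent.Propositional using (_×-↔_)
open import Data.Sum using (_⊎_; inj₁; inj₂; [_,_]′)
open import Data.Sum.Function.Propositional using (_⊎-↔_)
open import Data.Unit.Polymorphic using (⊤; tt)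
open import Data.Vec using (Vec; []; _∷_; _∷ʳ_; lookup; init; last; initLast)
open import Data.Vec.Properties using (init-∷ʳ; last-∷ʳ)
open import Function.Base using (id; _∘_)
open import Function.Bundles using (Equivalence; Inverse; mk↔ₛ′)
open import Function.Properties.Inverse using (↔-refl; ↔-sym; ↔-trans)
open import Function.Related.Propositional using (module EquationalReasoning; K-reflexive)
open import Function.Related.TypeIsomorphisms
  using (Σ-assoc; Σ-distribʳ-⊎; Σ-distribˡ-⊎; ×-identityˡ; ⊎-comm)
open import Level using (0ℓ)
open import Relation.Binary.PropositionalEquality
open import Relation.Nullary using (¬_; yes; no; does; contradiction)
open import Relation.Nullary.Decidable using (dec-true; dec-false; recompute)

private
  variable
    A : Set
    n : ℕ
    x v : ℕ
    i j : Fin n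

Σ-Fin-suc↔ : ∀ (P : Fin (suc n) → Set) → Σ (Fin (suc n)) P ↔ (P zero ⊎ Σ[ i ∈ Fin n ] P (suc i))
Σ-Fin-suc↔ P = mk↔ₛ′ Fin.∃-toSum [ Fin.∃-here , Fin.∃-there ]′
  (λ { (inj₁ _) → refl ; (inj₂ _) → refl }) (λ { (zero , _) → refl ; (suc _ , _) → refl })

Fin-sum↔Σ : ∀ (f : ℕ → ℕ) n → Fin (sum (applyUpTo f n)) ↔ (Σ[ i ∈ Fin n ] Fin (f (toℕ i)))
Fin-sum↔Σ f zero    = mk↔ₛ′ (λ ()) (λ ()) (λ ()) (λ ())
Fin-sum↔Σ f (suc n) = begin
  Fin (f 0 + sum (applyUpTo (f ∘ suc) n))             ↔⟨ Fin.+↔⊎ ⟩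
  (Fin (f 0) ⊎ Fin (sum (applyUpTo (f ∘ suc) n)))     ↔⟨ ↔-refl ⊎-↔ Fin-sum↔Σ (f ∘ suc) n ⟩
  (Fin (f 0) ⊎ Σ[ i ∈ Fin n ] Fin (f (suc (toℕ i))))  ↔⟨ Σ-Fin-suc↔ _ ⟨
  (Σ[ i ∈ Fin (suc n) ] Fin (f (toℕ i)))              ∎
  where open EquationalReasoning

partition-by : ∀ {X : Set} (f : X → ℕ) n → (∀ x → f x < n) →
               X ↔ (Σ[ i ∈ Fin n ] Σ[ x ∈ X ] f x ≡ toℕ i)
partition-by {X} f n f<n = mk↔ₛ′ to (proj₁ ∘ proj₂) to∘from (λ _ → refl)
  where
  to : X → Σ[ i ∈ Fin n ] Σ[ x ∈ X ] f x ≡ toℕ i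
  to x = Fin.fromℕ< (f<n x) , x , sym (Fin.toℕ-fromℕ< (f<n x))

  to∘from : ∀ y → to (proj₁ (proj₂ y)) ≡ y
  to∘from (i , x , fx≡i) with Fin.toℕ-injective (trans (Fin.toℕ-fromℕ< (f<n x)) fx≡i)
  ... | refl = cong (λ p → i , x , p) (≡-irrelevant _ _)

Σ-fibre-× : ∀ {X : Set} (f : X → ℕ) (B : ℕ → Set) k →
            (Σ[ x ∈ X ] (B (f x) × f x ≡ k)) ↔ (B k × Σ[ x ∈ X ] f x ≡ k)
Σ-fibre-× f B k = mk↔ₛ′ (λ { (x , b , refl) → b , x , refl }) (λ { (b , x , refl) → x , b , refl })
  (λ { (b , x , refl) → refl }) (λ { (x , b , refl) → refl })

suc≡suc↔ : ∀ {a b : ℕ} → (suc a ≡ suc b) ↔ (a ≡ b)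
suc≡suc↔ = mk↔ₛ′ (λ { refl → refl }) (λ { refl → refl }) (λ { refl → refl }) (λ { refl → refl })

count : (ℕ → Bool) → ℕ → ℕ
count p zero    = zero
count p (suc n) = if p n then suc (count p n) else count p n

Below : (ℕ → Bool) → ℕ → Set
Below p n = Σ[ v ∈ ℕ ] (v < n × T (p v))

Below-≡ : ∀ {p} {v : ℕ} {v<n v<n′ : v < n} {t t′ : T (p v)} →
          _≡_ {A = Below p n} (v , v<n , t) (v , v<n′ , t′)
Below-≡ {v<n = v<n} {v<n′} {t} {t′} =
  cong₂ (λ l u → _ , l , u) (<-irrelevant v<n v<n′) (T-irrelevant t t′)

Below-suc↔ : ∀ p n → Below p (suc n) ↔ (T (p n) ⊎ Below p n)
Below-suc↔ p n = mk↔ₛ′ to from to∘from from∘to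
  where
  to : Below p (suc n) → T (p n) ⊎ Below p n
  to (v , v<1+n , t) with v ≟ n
  ... | yes refl = inj₁ t
  ... | no  v≢n  = inj₂ (v , ≤∧≢⇒< (s≤s⁻¹ v<1+n) v≢n , t)

  from : T (p n) ⊎ Below p n → Below p (suc n)
  from (inj₁ t)             = n , ≤-refl , t
  from (inj₂ (v , v<n , t)) = v , m<n⇒m<1+n v<n , t

  to∘from : ∀ y → to (from y) ≡ y
  to∘from (inj₁ t) with n ≟ n
  ... | yes refl = refl
  ... | no  n≢n  = contradiction refl n≢n
  to∘from (inj₂ (v , v<n , t)) with v ≟ n
  ... | yes refl = ⊥-elim (<-irrefl refl v<n)
  ... | no  _    = cong inj₂ Below-≡

  from∘to : ∀ y → from (to y) ≡ y
  from∘to (v , _ , _) with v ≟ n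
  ... | yes refl = Below-≡
  ... | no  _    = Below-≡

T⊎Fin↔Fin : ∀ b c → (T b ⊎ Fin c) ↔ Fin (if b then suc c else c)
T⊎Fin↔Fin true  c = mk↔ₛ′ [ (λ _ → zero) , suc ]′ (λ { zero → inj₁ _ ; (suc i) → inj₂ i })
  (λ { zero → refl ; (suc i) → refl }) (λ { (inj₁ _) → refl ; (inj₂ i) → refl })
T⊎Fin↔Fin false c = mk↔ₛ′ [ (λ ()) , id ]′ inj₂ (λ _ → refl) (λ { (inj₁ ()) ; (inj₂ i) → refl })

Below↔Fin-count : ∀ p n → Below p n ↔ Fin (count p n)
Below↔Fin-count p zero    = mk↔ₛ′ (λ ()) (λ ()) (λ ()) (λ ())
Below↔Fin-count p (suc n) = begin
  Below p (suc n)              ↔⟨ Below-suc↔ p n ⟩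
  (T (p n) ⊎ Below p n)        ↔⟨ ↔-refl ⊎-↔ Below↔Fin-count p n ⟩
  (T (p n) ⊎ Fin (count p n))  ↔⟨ T⊎Fin↔Fin (p n) (count p n) ⟩
  Fin (count p (suc n))        ∎
  where open EquationalReasoning

count-cong : ∀ {p q} n → (∀ v → v < n → p v ≡ q v) → count p n ≡ count q n
count-cong zero    _   = refl
count-cong (suc n) p≗q = cong₂ (λ b c → if b then suc c else c)
  (p≗q n ≤-refl) (count-cong n (λ v v<n → p≗q v (m<n⇒m<1+n v<n)))

count≤ : ∀ p n → count p n ≤ n
count≤ p zero    = z≤n
count≤ p (suc n) with p n
... | true  = s≤s (count≤ p n)
... | false = m≤n⇒m≤1+n (count≤ p n)

count< : ∀ {p v} n → p v ≡ false → v < n → count p n < n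
count< {p} {v} (suc n) pv≡false v<1+n with v ≟ n
... | yes refl rewrite pv≡false = s≤s (count≤ p v)
... | no  v≢n  with p n
...   | true  = s≤s (count< n pv≡false (≤∧≢⇒< (s≤s⁻¹ v<1+n) v≢n))
...   | false = m<n⇒m<1+n (count< n pv≡false (≤∧≢⇒< (s≤s⁻¹ v<1+n) v≢n))

count-remove : ∀ {p q v} n → p v ≡ true → q v ≡ false → (∀ u → u ≢ v → q u ≡ p u) → v < n →
               suc (count q n) ≡ count p n
count-remove {p} {q} {v} (suc n) pv≡true qv≡false q≗p v<1+n with v ≟ n
... | yes refl rewrite pv≡true | qv≡false =
  cong suc (count-cong v (λ u u<v → q≗p u (<⇒≢ u<v)))
... | no  v≢n  rewrite q≗p n (≢-sym v≢n) with p n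
...   | true  = cong suc (count-remove n pv≡true qv≡false q≗p (≤∧≢⇒< (s≤s⁻¹ v<1+n) v≢n))
...   | false = count-remove n pv≡true qv≡false q≗p (≤∧≢⇒< (s≤s⁻¹ v<1+n) v≢n)

inject₁-mono-< : i Fin.< j → inject₁ i Fin.< inject₁ j
inject₁-mono-< {i = i} {j = j} = subst₂ _<_ (sym (toℕ-inject₁ i)) (sym (toℕ-inject₁ j))

inject₁-cancel-< : inject₁ i Fin.< inject₁ j → i Fin.< j
inject₁-cancel-< {i = i} {j = j} = subst₂ _<_ (toℕ-inject₁ i) (toℕ-inject₁ j)

inject₁<fromℕ : ∀ (i : Fin n) → inject₁ i Fin.< fromℕ n
inject₁<fromℕ {n} i = subst (toℕ (inject₁ i) <_) (sym (toℕ-fromℕ n)) (inject₁ℕ< i)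

fromℕ≮ : ∀ (j : Fin (suc n)) → ¬ (fromℕ n Fin.< j)
fromℕ≮ j fromℕ<j = <⇒≱ fromℕ<j (≤fromℕ j)

lookup-∷ʳ-inject₁ : ∀ (ys : Vec A n) x i → lookup (ys ∷ʳ x) (inject₁ i) ≡ lookup ys i
lookup-∷ʳ-inject₁ (y ∷ ys) x zero    = refl
lookup-∷ʳ-inject₁ (y ∷ ys) x (suc i) = lookup-∷ʳ-inject₁ ys x i

lookup-∷ʳ-fromℕ : ∀ (ys : Vec A n) x → lookup (ys ∷ʳ x) (fromℕ n) ≡ x
lookup-∷ʳ-fromℕ []       x = refl
lookup-∷ʳ-fromℕ (y ∷ ys) x = lookup-∷ʳ-fromℕ ys x

init-∷ʳ-last : ∀ (xs : Vec A (suc n)) → init xs ∷ʳ last xs ≡ xs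
init-∷ʳ-last xs = sym (proj₂ (proj₂ (initLast xs)))

lookup-fromℕ : ∀ (xs : Vec A (suc n)) → lookup xs (fromℕ n) ≡ last xs
lookup-fromℕ xs = begin
  lookup xs (fromℕ _)                    ≡⟨ cong (λ ys → lookup ys (fromℕ _)) (init-∷ʳ-last xs) ⟨
  lookup (init xs ∷ʳ last xs) (fromℕ _)  ≡⟨ lookup-∷ʳ-fromℕ (init xs) (last xs) ⟩
  last xs                                ∎
  where open ≡-Reasoning

fresh : Vec ℕ n → ℕ → Bool
fresh []       v = true
fresh (y ∷ ys) v = not (does (y ≟ v)) ∧ fresh ys v

fresh-lookup : ∀ (ys : Vec ℕ n) i → lookup ys i ≡ v → fresh ys v ≡ false
fresh-lookup (y ∷ ys) zero    refl rewrite dec-true (y ≟ y) refl  = refl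
fresh-lookup (y ∷ ys) (suc i) refl rewrite fresh-lookup ys i refl = ∧-zeroʳ _

fresh⇒≢ : ∀ (ys : Vec ℕ n) i → T (fresh ys v) → lookup ys i ≢ v
fresh⇒≢ ys i v-fresh yi≡v = subst T (fresh-lookup ys i yi≡v) v-fresh

≢⇒fresh : ∀ (ys : Vec ℕ n) → (∀ i → lookup ys i ≢ v) → T (fresh ys v)
≢⇒fresh         []       _  = _
≢⇒fresh {v = v} (y ∷ ys) ≢v rewrite dec-false (y ≟ v) (≢v zero) = ≢⇒fresh ys (≢v ∘ suc)

fresh-∷ʳ : ∀ (ys : Vec ℕ n) → x ≢ v → fresh (ys ∷ʳ x) v ≡ fresh ys v
fresh-∷ʳ {x = x} {v} []       x≢v rewrite dec-false (x ≟ v) x≢v = refl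
fresh-∷ʳ {v = v}     (y ∷ ys) x≢v = cong (not (does (y ≟ v)) ∧_) (fresh-∷ʳ ys x≢v)

Bounded : Vec ℕ n → Set
Bounded xs = ∀ i → lookup xs i ≤ toℕ i

Avoids : Vec ℕ n → Set
Avoids {n} xs = ∀ (i j k : Fin n) → i Fin.< j → j Fin.< k →
                lookup xs j ≢ lookup xs k → lookup xs i ≢ lookup xs k

Admissible : Vec ℕ (suc n) → ℕ → Set
Admissible ys x = x ≡ last ys ⊎ T (fresh ys x)

fresh-above : ∀ (ys : Vec ℕ n) → Bounded ys → n ≤ v → fresh ys v ≡ true
fresh-above ys bounded n≤v = Equivalence.to T-≡ (≢⇒fresh ys λ i →
  <⇒≢ (≤-<-trans (bounded i) (<-≤-trans (Fin.toℕ<n i) n≤v)))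

last≤ : ∀ (ys : Vec ℕ (suc n)) → Bounded ys → last ys ≤ n
last≤ {n} ys bounded = subst₂ _≤_ (lookup-fromℕ ys) (toℕ-fromℕ n) (bounded (fromℕ n))

bounded-∷ʳ⁺ : ∀ (ys : Vec ℕ n) → Bounded ys → x ≤ n → Bounded (ys ∷ʳ x)
bounded-∷ʳ⁺ {n} {x} ys bounded x≤n i with view i
... | ‵fromℕ     = subst₂ _≤_ (sym (lookup-∷ʳ-fromℕ ys x)) (sym (toℕ-fromℕ n)) x≤n
... | ‵inject₁ j = subst₂ _≤_ (sym (lookup-∷ʳ-inject₁ ys x j)) (sym (toℕ-inject₁ j)) (bounded j)

bounded-∷ʳ⁻ : ∀ (ys : Vec ℕ n) → Bounded (ys ∷ʳ x) → Bounded ys × x ≤ n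
bounded-∷ʳ⁻ {n} {x} ys bounded =
  (λ i → subst₂ _≤_ (lookup-∷ʳ-inject₁ ys x i) (toℕ-inject₁ i) (bounded (inject₁ i))) ,
  subst₂ _≤_ (lookup-∷ʳ-fromℕ ys x) (toℕ-fromℕ n) (bounded (fromℕ n))

≢last⇒<fromℕ : ∀ (ys : Vec ℕ (suc n)) i → lookup ys i ≢ last ys → i Fin.< fromℕ n
≢last⇒<fromℕ ys i ≢last = Fin.≤∧≢⇒< (≤fromℕ i) (λ { refl → ≢last (lookup-fromℕ ys) })

avoids-∷ʳ⁺ : ∀ (ys : Vec ℕ (suc n)) → Avoids ys → Admissible ys x → Avoids (ys ∷ʳ x)
avoids-∷ʳ⁺ {x = x} ys avoids admissible i j k i<j j<k with view i | view j | view k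
... | ‵fromℕ     | _          | _          = ⊥-elim (fromℕ≮ k (<-trans i<j j<k))
... | ‵inject₁ _ | ‵fromℕ     | _          = ⊥-elim (fromℕ≮ k j<k)
... | ‵inject₁ i | ‵inject₁ j | ‵inject₁ k = λ yj≢yk yi≡yk →
  avoids i j k (inject₁-cancel-< i<j) (inject₁-cancel-< j<k)
    (subst₂ _≢_ (lookup-∷ʳ-inject₁ ys x j) (lookup-∷ʳ-inject₁ ys x k) yj≢yk)
    (subst₂ _≡_ (lookup-∷ʳ-inject₁ ys x i) (lookup-∷ʳ-inject₁ ys x k) yi≡yk)
... | ‵inject₁ i | ‵inject₁ j | ‵fromℕ     = λ yj≢x yi≡x → by admissible
  (subst₂ _≢_ (lookup-∷ʳ-inject₁ ys x j) (lookup-∷ʳ-fromℕ ys x) yj≢x)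
  (subst₂ _≡_ (lookup-∷ʳ-inject₁ ys x i) (lookup-∷ʳ-fromℕ ys x) yi≡x)
  where
  by : Admissible ys x → lookup ys j ≢ x → lookup ys i ≢ x
  by (inj₁ refl) yj≢x yi≡x =
    avoids i j (fromℕ _) (inject₁-cancel-< i<j) (≢last⇒<fromℕ ys j yj≢x)
      (subst (lookup ys j ≢_) (sym (lookup-fromℕ ys)) yj≢x) (trans yi≡x (sym (lookup-fromℕ ys)))
  by (inj₂ x-fresh) _ = fresh⇒≢ ys i x-fresh

avoids-∷ʳ⁻ : ∀ (ys : Vec ℕ (suc n)) → Avoids (ys ∷ʳ x) → Avoids ys × Admissible ys x
avoids-∷ʳ⁻ {n} {x} ys avoids = avoids-init , admissible
  where
  lookup-inject₁ : ∀ i → lookup (ys ∷ʳ x) (inject₁ i) ≡ lookup ys i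
  lookup-inject₁ = lookup-∷ʳ-inject₁ ys x

  avoids-init : Avoids ys
  avoids-init i j k i<j j<k yj≢yk yi≡yk =
    avoids (inject₁ i) (inject₁ j) (inject₁ k) (inject₁-mono-< i<j) (inject₁-mono-< j<k)
      (subst₂ _≢_ (sym (lookup-inject₁ j)) (sym (lookup-inject₁ k)) yj≢yk)
      (subst₂ _≡_ (sym (lookup-inject₁ i)) (sym (lookup-inject₁ k)) yi≡yk)

  admissible : Admissible ys x
  admissible with x ≟ last ys
  ... | yes x≡last = inj₁ x≡last
  ... | no  x≢last = inj₂ (≢⇒fresh ys λ i yi≡x →
    avoids (inject₁ i) (inject₁ (fromℕ n)) (fromℕ (suc n))
      (inject₁-mono-< (≢last⇒<fromℕ ys i (x≢last ∘ trans (sym yi≡x))))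
      (inject₁<fromℕ (fromℕ n))
      (subst₂ _≢_ (sym (trans (lookup-inject₁ (fromℕ n)) (lookup-fromℕ ys)))
                  (sym (lookup-∷ʳ-fromℕ ys x)) (x≢last ∘ sym))
      (subst₂ _≡_ (sym (lookup-inject₁ i)) (sym (lookup-∷ʳ-fromℕ ys x)) yi≡x))

open AvoidingInvSeq

record Extension (ys : Vec ℕ (suc n)) : Set where
  constructor extension
  field
    value       : ℕ
    .bounded    : value ≤ suc n
    .admissible : Admissible ys value
open Extension

AvoidingInvSeq-≡ : ∀ {xs ys : Vec ℕ n} .{bx ax by ay} → xs ≡ ys → mk xs bx ax ≡ mk ys by ay
AvoidingInvSeq-≡ refl = refl

extension-≡ : ∀ {ys : Vec ℕ (suc n)} {x y : Extension ys} → value x ≡ value y → x ≡ y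
extension-≡ refl = refl

Σ-extension-≡ : ∀ {ys ys′ : Vec ℕ (suc n)} {x x′ : ℕ} .{b a b′ a′ xb xa xb′ xa′} →
                ys ≡ ys′ → x ≡ x′ →
                _≡_ {A = Σ (AvoidingInvSeq (suc n)) (Extension ∘ seq)}
                  (mk ys b a , extension x xb xa) (mk ys′ b′ a′ , extension x′ xb′ xa′)
Σ-extension-≡ refl refl = refl

extend↔ : Σ (AvoidingInvSeq (suc n)) (Extension ∘ seq) ↔ AvoidingInvSeq (suc (suc n))
extend↔ {n} = mk↔ₛ′ extend unextend
  (λ { (mk xs _ _) → AvoidingInvSeq-≡ (init-∷ʳ-last xs) })
  (λ { (mk ys _ _ , extension x _ _) → Σ-extension-≡ (init-∷ʳ x ys) (last-∷ʳ x ys) })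
  where
  extend : Σ (AvoidingInvSeq (suc n)) (Extension ∘ seq) → AvoidingInvSeq (suc (suc n))
  extend (mk ys b a , extension x xb xa) =
    mk (ys ∷ʳ x) (bounded-∷ʳ⁺ ys b xb) (avoids-∷ʳ⁺ ys a xa)

  unextend : AvoidingInvSeq (suc (suc n)) → Σ (AvoidingInvSeq (suc n)) (Extension ∘ seq)
  unextend (mk xs b a) =
    mk (init xs) (proj₁ (bounded-∷ʳ⁻ (init xs) (unsnoc Bounded b)))
                 (proj₁ (avoids-∷ʳ⁻ (init xs) (unsnoc Avoids a))) ,
    extension (last xs) (proj₂ (bounded-∷ʳ⁻ (init xs) (unsnoc Bounded b)))
                        (proj₂ (avoids-∷ʳ⁻ (init xs) (unsnoc Avoids a)))
    where
    unsnoc : (P : Vec ℕ (suc (suc n)) → Set) → P xs → P (init xs ∷ʳ last xs)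
    unsnoc P = subst P (sym (init-∷ʳ-last xs))

Fresh : Vec ℕ n → Set
Fresh {n} ys = Below (fresh ys) (suc n)

freshCount : Vec ℕ n → ℕ
freshCount {n} ys = count (fresh ys) (suc n)

Extension↔ : ∀ (ys : Vec ℕ (suc n)) → .(Bounded ys) → Extension ys ↔ (⊤ {0ℓ} ⊎ Fresh ys)
Extension↔ {n} ys bounded = mk↔ₛ′ to from to∘from from∘to
  where
  admissible⇒fresh : x ≢ last ys → Admissible ys x → T (fresh ys x)
  admissible⇒fresh x≢last (inj₁ x≡last) = contradiction x≡last x≢last
  admissible⇒fresh x≢last (inj₂ x-fresh) = x-fresh

  to : Extension ys → ⊤ ⊎ Fresh ys
  to (extension x x≤1+n admissible) with x ≟ last ys
  ... | yes _      = inj₁ tt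
  ... | no  x≢last = inj₂ (x , s≤s (recompute (x ≤? suc n) x≤1+n) ,
                           recompute (T? (fresh ys x)) (admissible⇒fresh x≢last admissible))

  from : ⊤ ⊎ Fresh ys → Extension ys
  from (inj₁ _)                     = extension (last ys) (m≤n⇒m≤1+n (last≤ ys bounded)) (inj₁ refl)
  from (inj₂ (v , v<2+n , v-fresh)) = extension v (s≤s⁻¹ v<2+n) (inj₂ v-fresh)

  to∘from : ∀ y → to (from y) ≡ y
  to∘from (inj₁ _) with last ys ≟ last ys
  ... | yes _         = refl
  ... | no  last≢last = contradiction refl last≢last
  to∘from (inj₂ (v , _ , v-fresh)) with v ≟ last ys
  ... | yes refl = ⊥-elim (fresh⇒≢ ys (fromℕ n) v-fresh (lookup-fromℕ ys))
  ... | no  _    = cong inj₂ Below-≡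

  from∘to : ∀ y → from (to y) ≡ y
  from∘to (extension x _ _) with x ≟ last ys
  ... | yes x≡last = extension-≡ (sym x≡last)
  ... | no  _      = refl

freshCount-∷ʳ : ∀ (ys : Vec ℕ n) → .(Bounded (ys ∷ʳ x)) →
                freshCount (ys ∷ʳ x) ≡ suc (count (fresh (ys ∷ʳ x)) (suc n))
freshCount-∷ʳ {n} {x} ys bounded = recompute (_ ≟ _)
  (cong (λ b → if b then suc c else c) (fresh-above (ys ∷ʳ x) bounded ≤-refl))
  where
  c : ℕ
  c = count (fresh (ys ∷ʳ x)) (suc n)

freshCount-∷ʳ-last : ∀ (ys : Vec ℕ (suc n)) → .(Bounded (ys ∷ʳ last ys)) →
                     freshCount (ys ∷ʳ last ys) ≡ suc (freshCount ys)
freshCount-∷ʳ-last {n} ys bounded = trans (freshCount-∷ʳ ys bounded)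
  (cong suc (count-cong (suc (suc n)) (λ u _ → fresh-∷ʳ-last u)))
  where
  fresh-∷ʳ-last : ∀ u → fresh (ys ∷ʳ last ys) u ≡ fresh ys u
  fresh-∷ʳ-last u with last ys ≟ u
  ... | yes refl   = trans
    (fresh-lookup (ys ∷ʳ last ys) (fromℕ (suc n)) (lookup-∷ʳ-fromℕ ys (last ys)))
    (sym (fresh-lookup ys (fromℕ n) (lookup-fromℕ ys)))
  ... | no  last≢u = fresh-∷ʳ ys last≢u

freshCount-∷ʳ-fresh : ∀ (ys : Vec ℕ n) → .(Bounded (ys ∷ʳ v)) → T (fresh ys v) → v < suc n →
                      freshCount (ys ∷ʳ v) ≡ freshCount ys
freshCount-∷ʳ-fresh {n} {v} ys bounded v-fresh v<1+n = trans (freshCount-∷ʳ ys bounded)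
  (count-remove (suc n) (Equivalence.to T-≡ v-fresh)
    (fresh-lookup (ys ∷ʳ v) (fromℕ n) (lookup-∷ʳ-fromℕ ys v))
    (λ u u≢v → fresh-∷ʳ ys (≢-sym u≢v)) v<1+n)

freshCount< : ∀ (e : AvoidingInvSeq (suc n)) → freshCount (seq e) < suc (suc n)
freshCount< (mk ys bounded _) = recompute (_ <? _)
  (count< {fresh ys} _ (fresh-lookup ys zero refl) (s≤s (≤-trans (bounded zero) z≤n)))

extensions-by-freshCount : ∀ (e : AvoidingInvSeq (suc n)) k →
  (Σ[ x ∈ Extension (seq e) ] freshCount (seq e ∷ʳ value x) ≡ k) ↔
  (suc (freshCount (seq e)) ≡ k ⊎ Fin (freshCount (seq e)) × freshCount (seq e) ≡ k)
extensions-by-freshCount (mk ys bounded _) k = begin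
  (Σ[ x ∈ Extension ys ] freshCount (ys ∷ʳ value x) ≡ k)
    ↔⟨ Σ.cong (↔-sym (Extension↔ ys bounded)) ↔-refl ⟨
  (Σ[ y ∈ ⊤ ⊎ Fresh ys ] freshCount (ys ∷ʳ value (Inverse.from (Extension↔ ys bounded) y)) ≡ k)
    ↔⟨ Σ-distribʳ-⊎ ⟩
  (⊤ × freshCount (ys ∷ʳ last ys) ≡ k ⊎ Σ[ (v , _) ∈ Fresh ys ] freshCount (ys ∷ʳ v) ≡ k)
    ↔⟨ ↔-refl ⊎-↔ Σ.congˡ (λ { {v , v<2+n , v-fresh} → K-reflexive (cong (_≡ k)
         (freshCount-∷ʳ-fresh ys (bounded-∷ʳ⁺ ys bounded (s≤s⁻¹ v<2+n)) v-fresh v<2+n)) }) ⟩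
  (⊤ × freshCount (ys ∷ʳ last ys) ≡ k ⊎ Fresh ys × freshCount ys ≡ k)
    ↔⟨ ↔-trans (×-identityˡ _ _) (K-reflexive (cong (_≡ k) (freshCount-∷ʳ-last ys
         (bounded-∷ʳ⁺ ys bounded (m≤n⇒m≤1+n (last≤ ys bounded))))))
       ⊎-↔ (Below↔Fin-count _ _ ×-↔ ↔-refl) ⟩
  (suc (freshCount ys) ≡ k ⊎ Fin (freshCount ys) × freshCount ys ≡ k)
    ∎
  where open EquationalReasoning

Fibre : ℕ → ℕ → Set
Fibre n k = Σ[ e ∈ AvoidingInvSeq n ] freshCount (seq e) ≡ k

Fibre-suc↔ : ∀ n k → Fibre (suc (suc n)) k ↔
  ((Σ[ e ∈ AvoidingInvSeq (suc n) ] suc (freshCount (seq e)) ≡ k) ⊎ Fin k × Fibre (suc n) k)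
Fibre-suc↔ n k = begin
  Fibre (suc (suc n)) k
    ↔⟨ Σ.cong extend↔ ↔-refl ⟨
  (Σ[ (e , x) ∈ Σ (AvoidingInvSeq (suc n)) (Extension ∘ seq) ] freshCount (seq e ∷ʳ value x) ≡ k)
    ↔⟨ Σ-assoc ⟩
  (Σ[ e ∈ AvoidingInvSeq (suc n) ] Σ[ x ∈ Extension (seq e) ] freshCount (seq e ∷ʳ value x) ≡ k)
    ↔⟨ Σ.congˡ (λ {e} → extensions-by-freshCount e k) ⟩
  (Σ[ e ∈ AvoidingInvSeq (suc n) ]
     (suc (freshCount (seq e)) ≡ k ⊎ Fin (freshCount (seq e)) × freshCount (seq e) ≡ k))
    ↔⟨ Σ-distribˡ-⊎ ⟩
  ((Σ[ e ∈ AvoidingInvSeq (suc n) ] suc (freshCount (seq e)) ≡ k) ⊎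
   (Σ[ e ∈ AvoidingInvSeq (suc n) ] (Fin (freshCount (seq e)) × freshCount (seq e) ≡ k)))
    ↔⟨ ↔-refl ⊎-↔ Σ-fibre-× (freshCount ∘ seq) Fin k ⟩
  ((Σ[ e ∈ AvoidingInvSeq (suc n) ] suc (freshCount (seq e)) ≡ k) ⊎ Fin k × Fibre (suc n) k)
    ∎
  where open EquationalReasoning

singleton : AvoidingInvSeq 1
singleton = mk (0 ∷ []) (λ { zero → z≤n }) (λ { zero zero _ () })

seq-singleton : ∀ (e : AvoidingInvSeq 1) → seq e ≡ 0 ∷ []
seq-singleton (mk (x ∷ []) bounded _) = cong (_∷ []) (recompute (x ≟ 0) (n≤0⇒n≡0 (bounded zero)))

AvoidingInvSeq-1↔⊤ : AvoidingInvSeq 1 ↔ ⊤ {0ℓ}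
AvoidingInvSeq-1↔⊤ = mk↔ₛ′ _ (λ _ → singleton) (λ _ → refl)
  (λ e → AvoidingInvSeq-≡ (sym (seq-singleton e)))

1≡↔Fin-S-1 : ∀ k → (1 ≡ k) ↔ Fin (S 1 k)
1≡↔Fin-S-1 zero                            = mk↔ₛ′ (λ ()) (λ ()) (λ ()) (λ ())
1≡↔Fin-S-1 (suc zero)                      =
  mk↔ₛ′ (λ _ → zero) (λ _ → refl) (λ { zero → refl }) (λ { refl → refl })
1≡↔Fin-S-1 (suc (suc k)) rewrite *-zeroʳ k = mk↔ₛ′ (λ ()) (λ ()) (λ ()) (λ ())

Fibre↔Fin-S : ∀ n k → Fibre (suc n) k ↔ Fin (S (suc n) k)
Fibre↔Fin-S zero k = begin
  Fibre 1 k
    ↔⟨ Σ.cong AvoidingInvSeq-1↔⊤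
         (λ {e} → K-reflexive (cong (λ s → freshCount s ≡ k) (seq-singleton e))) ⟩
  (⊤ × 1 ≡ k)   ↔⟨ ×-identityˡ _ _ ⟩
  (1 ≡ k)       ↔⟨ 1≡↔Fin-S-1 k ⟩
  Fin (S 1 k)   ∎
  where open EquationalReasoning
Fibre↔Fin-S (suc n) zero = ↔-trans (Fibre-suc↔ n 0) (mk↔ₛ′
  (λ { (inj₁ (_ , ())) ; (inj₂ (() , _)) }) (λ ()) (λ ()) (λ { (inj₁ (_ , ())) ; (inj₂ (() , _)) }))
Fibre↔Fin-S (suc n) (suc k) = begin
  Fibre (suc (suc n)) (suc k)
    ↔⟨ Fibre-suc↔ n (suc k) ⟩
  ((Σ[ e ∈ AvoidingInvSeq (suc n) ] suc (freshCount (seq e)) ≡ suc k) ⊎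
   Fin (suc k) × Fibre (suc n) (suc k))
    ↔⟨ Σ.congˡ suc≡suc↔ ⊎-↔ ↔-refl ⟩
  (Fibre (suc n) k ⊎ Fin (suc k) × Fibre (suc n) (suc k))
    ↔⟨ Fibre↔Fin-S n k ⊎-↔ (↔-refl ×-↔ Fibre↔Fin-S n (suc k)) ⟩
  (Fin (S (suc n) k) ⊎ Fin (suc k) × Fin (S (suc n) (suc k)))
    ↔⟨ ⊎-comm _ _ ⟩
  (Fin (suc k) × Fin (S (suc n) (suc k)) ⊎ Fin (S (suc n) k))
    ↔⟨ Fin.*↔× ⊎-↔ ↔-refl ⟨
  (Fin (suc k * S (suc n) (suc k)) ⊎ Fin (S (suc n) k))
    ↔⟨ Fin.+↔⊎ ⟨
  Fin (S (suc (suc n)) (suc k))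
    ∎
  where open EquationalReasoning

mainTheorem3 : ∀ (n : ℕ) → n ≥ 1 → AvoidingInvSeq n ↔ Fin (Bell n)
mainTheorem3 (suc n) _ = begin
  AvoidingInvSeq (suc n)
    ↔⟨ partition-by (freshCount ∘ seq) (suc (suc n)) freshCount< ⟩
  (Σ[ i ∈ Fin (suc (suc n)) ] Fibre (suc n) (toℕ i))
    ↔⟨ Σ.congˡ (λ {i} → Fibre↔Fin-S n (toℕ i)) ⟩
  (Σ[ i ∈ Fin (suc (suc n)) ] Fin (S (suc n) (toℕ i)))
    ↔⟨ Fin-sum↔Σ (S (suc n)) (suc (suc n)) ⟨
  Fin (sum (applyUpTo (S (suc n)) (suc (suc n))))
    ≡⟨ cong (Fin ∘ sum) (map-applyUpTo id (S (suc n)) (suc (suc n))) ⟨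
  Fin (Bell (suc n))
    ∎
  where open EquationalReasoning
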